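{- For any $\mathsf{T}$-term $P$ and any $*$-term $Q$, the unique $\mathsf{T}$-$*$-decomposition of $\mathrm{fe}(P \wedge^{\bullet} Q)$ is $(\mathrm{fe}(P)[\mathsf{T}\mapsto\Box], \mathrm{fe}(Q))$.
   Context: Let $A$ be a countable set of atoms. FEL-terms: $P ::= a \ (a\in A) \mid \mathsf{T} \mid \mathsf{F} \mid \neg P \mid (P \wedge^{\bullet} P) \mid (P \vee^{\bullet} P)$. Subgrammars (with $a \in A$): $\mathsf{T}$-terms $P^{\mathsf{T}} ::= \mathsf{T} \mid a \vee^{\bullet} P^{\mathsf{T}}$; $\ell$-terms $P^{\ell} ::= a \wedge^{\bullet} P^{\mathsf{T}} \mid \neg a \wedge^{\bullet} P^{\mathsf{T}}$; $*$-terms $P^* ::= P^c \mid P^d$, with $P^c ::= P^{\ell} \mid P^* \wedge^{\bullet} P^d$ and $P^d ::= P^{\ell} \mid P^* \vee^{\bullet} P^c$. $\mathcal{T}$ is the set of finite binary trees with leaves in $\{\mathsf{T},\mathsf{F}\}$: $\mathsf{T}, \mathsf{F}\in\mathcal{T}$, $(X \trianglelefteq a \trianglerighteq Y)\in\mathcal{T}$ for $X,Y\in\mathcal{T}$, $a\in A$; $\mathcal{T}_{\Box}$ is the analogous set of trees with leaves in $\{\mathsf{T},\mathsf{F},\Box\}$. Leaf replacement $X[\ell_1\mapsto Y_1, \ell_2\mapsto Y_2]$ replaces every leaf $\ell_i$ of $X$ by $Y_i$, other leaves unchanged. $\mathrm{fe}$: $\mathrm{fe}(\mathsf{T}) = \mathsf{T}$,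 $\mathrm{fe}(\mathsf{F}) = \mathsf{F}$, $\mathrm{fe}(a) = \mathsf{T} \trianglelefteq a \trianglerighteq \mathsf{F}$, $\mathrm{fe}(\neg P) = \mathrm{fe}(P)[\mathsf{T}\mapsto\mathsf{F}, \mathsf{F}\mapsto\mathsf{T}]$, $\mathrm{fe}(P \wedge^{\bullet} Q) = \mathrm{fe}(P)[\mathsf{T}\mapsto \mathrm{fe}(Q), \mathsf{F}\mapsto \mathrm{fe}(Q)[\mathsf{T}\mapsto\mathsf{F}]]$, $\mathrm{fe}(P \vee^{\bullet} Q) = \mathrm{fe}(P)[\mathsf{T}\mapsto \mathrm{fe}(Q)[\mathsf{F}\mapsto\mathsf{T}], \mathsf{F}\mapsto \mathrm{fe}(Q)]$. For $X\in\mathcal{T}$, a pair $(Y,Z)\in\mathcal{T}_{\Box}\times\mathcal{T}$ is a $\mathsf{T}$-$*$-decomposition (tsd) of $X$ if $X = Y[\Box\mapsto Z]$, $Y$ contains neither $\mathsf{T}$ nor $\mathsf{F}$, and there is no pair $(U,V)\in\mathcal{T}_{\Box}\times\mathcal{T}$ with $Z = U[\Box\mapsto V]$, $U$ containing $\Box$, $U\neq\Box$, and $U$ containing neither $\mathsf{T}$ nor $\mathsf{F}$. -}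

module Defs where

open import Data.Nat using (ℕ)
open import Data.Product using (_×_; Σ; ∃; _,_)
open import Relation.Nullary using (¬_; Dec; yes; no)
open import Relation.Binary.PropositionalEquality using (_≡_; _≢_; refl)

Atom : Set
Atom = ℕ

data Term : Set where
  at   : Atom → Term
  𝐓 𝐅  : Term
  ¬'_  : Term → Term
  _∧•_ : Term → Term → Term
  _∨•_ : Term → Term → Term

data TTerm : Term → Set where
  tT  : TTerm 𝐓
  tOr : ∀ a {P} → TTerm P → TTerm (at a ∨• P)

data LTerm : Term → Set where
  lPos : ∀ a {P} → TTerm P → LTerm (at a ∧• P)
  lNeg : ∀ a {P} → TTerm P → LTerm ((¬' at a) ∧• P)

data StarTerm : Term → Set
data CTerm : Term → Set
data DTerm : Term → Set

data StarTerm where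
  sC : ∀ {P} → CTerm P → StarTerm P
  sD : ∀ {P} → DTerm P → StarTerm P

data CTerm where
  cL   : ∀ {P} → LTerm P → CTerm P
  cAnd : ∀ {P Q} → StarTerm P → DTerm Q → CTerm (P ∧• Q)

data DTerm where
  dL  : ∀ {P} → LTerm P → DTerm P
  dOr : ∀ {P Q} → StarTerm P → CTerm Q → DTerm (P ∨• Q)

-- Leaves and binary trees.  𝒯_□ is all of Tree; 𝒯 is the trees without □.
data Leaf : Set where
  lT lF □ : Leaf

data Tree : Set where
  leaf : Leaf → Tree
  node : Tree → Atom → Tree → Tree   -- node X a Y  =  X ⊴ a ⊵ Y

data Contains (ℓ : Leaf) : Tree → Set where
  here  : Contains ℓ (leaf ℓ)
  left  : ∀ {X a Y} → Contains ℓ X → Contains ℓ (node X a Y)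
  right : ∀ {X a Y} → Contains ℓ Y → Contains ℓ (node X a Y)

In𝒯 : Tree → Set
In𝒯 X = ¬ Contains □ X

subst : Tree → (Leaf → Tree) → Tree
subst (leaf ℓ) σ = σ ℓ
subst (node X a Y) σ = node (subst X σ) a (subst Y σ)

_≟L_ : (l m : Leaf) → Dec (l ≡ m)
lT ≟L lT = yes refl
lT ≟L lF = no (λ ())
lT ≟L □  = no (λ ())
lF ≟L lT = no (λ ())
lF ≟L lF = yes refl
lF ≟L □  = no (λ ())
□  ≟L lT = no (λ ())
□  ≟L lF = no (λ ())
□  ≟L □  = yes refl

-- X[ℓ₁ ↦ Y₁]
rep1 : Tree → Leaf → Tree → Tree
rep1 X ℓ₁ Y₁ = subst X σ
  where
  σ : Leaf → Tree
  σ l with l ≟L ℓ₁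
  ... | yes _ = Y₁
  ... | no _  = leaf l

-- X[ℓ₁ ↦ Y₁, ℓ₂ ↦ Y₂]  (used with ℓ₁ ≠ ℓ₂)
rep2 : Tree → Leaf → Tree → Leaf → Tree → Tree
rep2 X ℓ₁ Y₁ ℓ₂ Y₂ = subst X σ
  where
  σ : Leaf → Tree
  σ l with l ≟L ℓ₁ | l ≟L ℓ₂
  ... | yes _ | _     = Y₁
  ... | no _  | yes _ = Y₂
  ... | no _  | no _  = leaf l

fe : Term → Tree
fe (at a)   = node (leaf lT) a (leaf lF)
fe 𝐓        = leaf lT
fe 𝐅        = leaf lF
fe (¬' P)   = rep2 (fe P) lT (leaf lF) lF (leaf lT)
fe (P ∧• Q) = rep2 (fe P) lT (fe Q) lF (rep1 (fe Q) lT (leaf lF))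
fe (P ∨• Q) = rep2 (fe P) lT (rep1 (fe Q) lF (leaf lT)) lF (fe Q)

IsTSD : Tree → Tree → Tree → Set
IsTSD X Y Z =
  In𝒯 Z
  × X ≡ rep1 Y □ Z
  × ¬ Contains lT Y × ¬ Contains lF Y
  × ¬ (Σ Tree λ U → Σ Tree λ V →
         In𝒯 V × Z ≡ rep1 U □ V × Contains □ U × U ≢ leaf □
         × ¬ Contains lT U × ¬ Contains lF U)

IsUniqueTSD : Tree → Tree → Tree → Set
IsUniqueTSD X Y Z = IsTSD X Y Z × (∀ Y' Z' → IsTSD X Y' Z' → Y' ≡ Y × Z' ≡ Z)

module Submission where

-- All leaves of fe P are T, so fe (P ∧• Q) = Y[□ ↦ fe Q] with Y = fe P[T ↦ □] a
-- template (a tree whose leaves are all □).  Maximality and uniqueness come from a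
-- height argument on perfect trees (all leaves at the same depth).  We write
-- Copies k V X when X is a complete tree of height k carrying a copy of V at each
-- of its bottom positions, and call X primitive when X is not Copies (1 + j) V X.
--   * For a *-term Q, fe Q is perfect, primitive and contains both T and F.  For
--     ℓ-terms this is direct; for ∧• and ∨• a tiling of fe Q₁[T ↦ A, F ↦ B] is
--     either pulled back to a tiling of fe Q₁ (tiles above the height of fe Q₁) or
--     pushed down to a common tiling of A and B (tiles below it), both impossible.
--   * A decomposition X = Y[□ ↦ Z] of a perfect tree X by a template Y is exactly
--     a tiling Copies k Z X with Y the top k levels of X.  Hence primitivity of fe Q
--     is the maximality condition, and two maximal decompositions of a perfect tree
--     coincide, which gives uniqueness.

open import Defs
open import Data.Nat using (ℕ; zero; suc; _+_; _≤_)
open import Data.Nat.Properties using (+-identityʳ; +-cancelʳ-≡; ≤-total; m≤n⇒∃[o]m+o≡n)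
open import Data.Product using (Σ; _×_; _,_; proj₁; proj₂)
open import Data.Sum using (_⊎_; inj₁; inj₂)
open import Data.Empty using (⊥; ⊥-elim)
open import Relation.Nullary using (¬_; yes; no)
open import Relation.Binary.PropositionalEquality
  using (_≡_; _≢_; refl; sym; trans; cong; cong₂) renaming (subst to transport)

contains-subst : ∀ {l l' σ} X → Contains l' X → Contains l (σ l') → Contains l (subst X σ)
contains-subst (leaf _)     here      c = c
contains-subst (node X a Y) (left c') c = left (contains-subst X c' c)
contains-subst (node X a Y) (right c') c = right (contains-subst Y c' c)

OnlyLeaf : Leaf → Tree → Set
OnlyLeaf l X = ∀ {m} → Contains m X → m ≡ l

subst-cong : ∀ {σ τ} X → (∀ {l} → Contains l X → σ l ≡ τ l) → subst X σ ≡ subst X τ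
subst-cong (leaf l)     h = h here
subst-cong (node X a Y) h =
  cong₂ (λ A B → node A a B) (subst-cong X (λ c → h (left c))) (subst-cong Y (λ c → h (right c)))

subst-only : ∀ {l σ τ} X → OnlyLeaf l X → σ l ≡ τ l → subst X σ ≡ subst X τ
subst-only {σ = σ} {τ} X only e = subst-cong X (λ c → transport (λ l → σ l ≡ τ l) (sym (only c)) e)

subst-subst : ∀ {σ τ} X → subst (subst X σ) τ ≡ subst X (λ l → subst (σ l) τ)
subst-subst (leaf l)     = refl
subst-subst (node X a Y) = cong₂ (λ A B → node A a B) (subst-subst X) (subst-subst Y)

rep1-leaf : ∀ X {l Y m} → Contains m (rep1 X l Y) → Contains m Y ⊎ (m ≢ l × Contains m X)
rep1-leaf (leaf l') {l} c with l' ≟L l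
rep1-leaf (leaf l') c    | yes _   = inj₁ c
rep1-leaf (leaf l') here | no l'≢l = inj₂ (l'≢l , here)
rep1-leaf (node X a Z) (left c) with rep1-leaf X c
... | inj₁ cY        = inj₁ cY
... | inj₂ (ne , cX) = inj₂ (ne , left cX)
rep1-leaf (node X a Z) (right c) with rep1-leaf Z c
... | inj₁ cY        = inj₁ cY
... | inj₂ (ne , cX) = inj₂ (ne , right cX)

rep1-removes : ∀ X {l m} → l ≢ m → ¬ Contains l (rep1 X l (leaf m))
rep1-removes X l≢m c with rep1-leaf X c
... | inj₁ here      = l≢m refl
... | inj₂ (l≢l , _) = l≢l refl

rep1-only : ∀ X {l m Y} → OnlyLeaf l X → OnlyLeaf m Y → OnlyLeaf m (rep1 X l Y)
rep1-only X onlyX onlyY c with rep1-leaf X c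
... | inj₁ cY        = onlyY cY
... | inj₂ (ne , cX) = ⊥-elim (ne (onlyX cX))

rep1-In𝒯 : ∀ X {l Y} → In𝒯 X → In𝒯 Y → In𝒯 (rep1 X l Y)
rep1-In𝒯 X nX nY c with rep1-leaf X c
... | inj₁ cY       = nY cY
... | inj₂ (_ , cX) = nX cX

rep2-In𝒯 : ∀ X {l₁ Y₁ l₂ Y₂} → In𝒯 X → In𝒯 Y₁ → In𝒯 Y₂ → In𝒯 (rep2 X l₁ Y₁ l₂ Y₂)
rep2-In𝒯 (leaf l) {l₁} {_} {l₂} nX n₁ n₂ with l ≟L l₁ | l ≟L l₂
... | yes _ | _     = n₁
... | no _  | yes _ = n₂
... | no _  | no _  = nX
rep2-In𝒯 (node X a Y) nX n₁ n₂ (left c)  = rep2-In𝒯 X (λ c' → nX (left c')) n₁ n₂ c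
rep2-In𝒯 (node X a Y) nX n₁ n₂ (right c) = rep2-In𝒯 Y (λ c' → nX (right c')) n₁ n₂ c

fe-In𝒯 : ∀ P → In𝒯 (fe P)
fe-In𝒯 (at a)   (left ())
fe-In𝒯 (at a)   (right ())
fe-In𝒯 𝐓        ()
fe-In𝒯 𝐅        ()
fe-In𝒯 (¬' P)   = rep2-In𝒯 (fe P) (fe-In𝒯 P) (λ ()) (λ ())
fe-In𝒯 (P ∧• Q) = rep2-In𝒯 (fe P) (fe-In𝒯 P) (fe-In𝒯 Q) (rep1-In𝒯 (fe Q) (fe-In𝒯 Q) (λ ()))
fe-In𝒯 (P ∨• Q) = rep2-In𝒯 (fe P) (fe-In𝒯 P) (rep1-In𝒯 (fe Q) (fe-In𝒯 Q) (λ ())) (fe-In𝒯 Q)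

-- Perfect trees: all leaves at depth n.

data Perfect : ℕ → Tree → Set where
  leafᵖ : ∀ {l} → Perfect 0 (leaf l)
  nodeᵖ : ∀ {n X a Y} → Perfect n X → Perfect n Y → Perfect (suc n) (node X a Y)

perfect-unique : ∀ {n m X} → Perfect n X → Perfect m X → n ≡ m
perfect-unique leafᵖ       leafᵖ       = refl
perfect-unique (nodeᵖ p _) (nodeᵖ q _) = cong suc (perfect-unique p q)

perfect-subst : ∀ {n m σ X} → Perfect n X → (∀ {l} → Contains l X → Perfect m (σ l))
  → Perfect (n + m) (subst X σ)
perfect-subst leafᵖ       h = h here
perfect-subst (nodeᵖ p q) h = nodeᵖ (perfect-subst p (λ c → h (left c))) (perfect-subst q (λ c → h (right c)))

perfect-subst-only : ∀ {n m l σ X} → Perfect n X → OnlyLeaf l X → Perfect m (σ l)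
  → Perfect (n + m) (subst X σ)
perfect-subst-only {m = m} {σ = σ} p only q =
  perfect-subst p (λ c → transport (λ l → Perfect m (σ l)) (sym (only c)) q)

rep1-perfect : ∀ {n X l m} → Perfect n X → Perfect n (rep1 X l (leaf m))
rep1-perfect {X = leaf l'} {l} leafᵖ with l' ≟L l
... | yes _ = leafᵖ
... | no _  = leafᵖ
rep1-perfect (nodeᵖ p q) = nodeᵖ (rep1-perfect p) (rep1-perfect q)

-- Tilings.  Copies k V X: X is a complete tree of height k with V at every bottom position.

Copies : ℕ → Tree → Tree → Set
Copies zero    V X            = X ≡ V
Copies (suc k) V (leaf _)     = ⊥
Copies (suc k) V (node X _ Y) = Copies k V X × Copies k V Y

copies-contains : ∀ k {V X l} → Copies k V X → Contains l V → Contains l X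
copies-contains zero    refl c = c
copies-contains (suc k) {X = node X a Y} (cX , _) c = left (copies-contains k cX c)

copies-contained : ∀ k {V X l} → Copies k V X → Contains l X → Contains l V
copies-contained zero    refl c = c
copies-contained (suc k) {X = node X a Y} (cX , _)  (left c)  = copies-contained k cX c
copies-contained (suc k) {X = node X a Y} (_ , cY)  (right c) = copies-contained k cY c

copies-split : ∀ k {j Z V X} → Copies k Z X → Copies (k + j) V X → Copies j V Z
copies-split zero    refl c = c
copies-split (suc k) {X = node X a Y} (cZ , _) (cV , _) = copies-split k cZ cV

Primitive : Tree → Set
Primitive X = ∀ j V → ¬ Copies (suc j) V X

Separated : Tree → Tree → Set
Separated A B = ∀ i V → Copies i V A → Copies i V B → ⊥

separated-by-leaf : ∀ {l A B} → Contains l A → ¬ Contains l B → Separated A B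
separated-by-leaf cA nB i V tA tB = nB (copies-contains i tB (copies-contained i tA cA))

separated-sym : ∀ {A B} → Separated A B → Separated B A
separated-sym sep i V tB tA = sep i V tA tB

separated-distinct : ∀ {A B} → Separated A B → A ≢ B
separated-distinct {A} sep A≡B = sep 0 A refl (sym A≡B)

primitive-node : ∀ {A a B} → Separated A B → Primitive (node A a B)
primitive-node sep j V (tA , tB) = sep j V tA tB

LeafInjective : (Leaf → Tree) → Set
LeafInjective σ = ∀ {l l'} → σ l ≡ σ l' → l ≡ l'

leaf-injective : ∀ {σ} → σ □ ≡ leaf □ → In𝒯 (σ lT) → In𝒯 (σ lF) → σ lT ≢ σ lF → LeafInjective σ
leaf-injective b nT nF d {lT} {lT} e = refl
leaf-injective b nT nF d {lT} {lF} e = ⊥-elim (d e)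
leaf-injective b nT nF d {lT} {□}  e = ⊥-elim (nT (transport (Contains □) (sym (trans e b)) here))
leaf-injective b nT nF d {lF} {lT} e = ⊥-elim (d (sym e))
leaf-injective b nT nF d {lF} {lF} e = refl
leaf-injective b nT nF d {lF} {□}  e = ⊥-elim (nF (transport (Contains □) (sym (trans e b)) here))
leaf-injective b nT nF d {□}  {lT} e = ⊥-elim (nT (transport (Contains □) (sym (trans (sym e) b)) here))
leaf-injective b nT nF d {□}  {lF} e = ⊥-elim (nF (transport (Contains □) (sym (trans (sym e) b)) here))
leaf-injective b nT nF d {□}  {□}  e = refl

node-injective : ∀ {A a B C c D} → node A a B ≡ node C c D → A ≡ C × a ≡ c × B ≡ D
node-injective refl = refl , refl , refl

subst-injective : ∀ {σ i A B} → LeafInjective σ → Perfect i A → Perfect i B → subst A σ ≡ subst B σ → A ≡ B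
subst-injective inj leafᵖ leafᵖ e = cong leaf (inj e)
subst-injective inj (nodeᵖ pA₁ pA₂) (nodeᵖ pB₁ pB₂) e with node-injective e
... | e₁ , refl , e₂ = cong₂ (λ L R → node L _ R) (subst-injective inj pA₁ pB₁ e₁) (subst-injective inj pA₂ pB₂ e₂)

copies-pullback : ∀ {σ} → LeafInjective σ → ∀ k {i V X} → Perfect (k + i) X → Copies k V (subst X σ)
  → Σ Tree λ W → Copies k W X × subst W σ ≡ V × Perfect i W
copies-pullback inj zero {X = X} p t = X , refl , t , p
copies-pullback inj (suc k) (nodeᵖ p q) (t₁ , t₂)
  with copies-pullback inj k p t₁ | copies-pullback inj k q t₂
... | W₁ , c₁ , e₁ , p₁ | W₂ , c₂ , e₂ , p₂ =
  W₁ , (c₁ , transport (λ W → Copies k W _) (subst-injective inj p₂ p₁ (trans e₂ (sym e₁))) c₂) , e₁ , p₁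

copies-pushdown : ∀ {σ n i V X l} → Perfect n X → Copies (n + i) V (subst X σ) → Contains l X → Copies i V (σ l)
copies-pushdown leafᵖ       t         here      = t
copies-pushdown (nodeᵖ p q) (t₁ , _)  (left c)  = copies-pushdown p t₁ c
copies-pushdown (nodeᵖ p q) (_ , t₂)  (right c) = copies-pushdown q t₂ c

primitive-subst : ∀ {σ n} X → Perfect n X → Primitive X → Contains lT X → Contains lF X
  → LeafInjective σ → Separated (σ lT) (σ lF) → Primitive (subst X σ)
primitive-subst {σ} {n} X p prim cT cF inj sep j V t with ≤-total (suc j) n
... | inj₁ j<n with m≤n⇒∃[o]m+o≡n j<n
...   | i , refl = prim j _ (proj₁ (proj₂ (copies-pullback inj (suc j) p t)))
primitive-subst {σ} {n} X p prim cT cF inj sep j V t | inj₂ n≤j with m≤n⇒∃[o]m+o≡n n≤j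
... | i , e = sep i V (copies-pushdown p t' cT) (copies-pushdown p t' cF)
  where
  t' : Copies (n + i) V (subst X σ)
  t' = transport (λ k → Copies k V (subst X σ)) (sym e) t

tterm-only : ∀ {P} → TTerm P → OnlyLeaf lT (fe P)
tterm-only tT here = refl
tterm-only (tOr a p) (right c) = tterm-only p c
tterm-only {at a ∨• P} (tOr a p) (left c) with rep1-leaf (fe P) c
... | inj₁ here     = refl
... | inj₂ (_ , cP) = tterm-only p cP

tterm-contains : ∀ {P} → TTerm P → Contains lT (fe P)
tterm-contains tT        = here
tterm-contains (tOr a p) = right (tterm-contains p)

tterm-perfect : ∀ {P} → TTerm P → Σ ℕ λ n → Perfect n (fe P)
tterm-perfect tT = 0 , leafᵖ
tterm-perfect (tOr a p) with tterm-perfect p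
... | n , q = suc n , nodeᵖ (rep1-perfect q) q

record StarShaped (Z : Tree) : Set where
  field
    height      : ℕ
    perfect     : Perfect height Z
    hasT        : Contains lT Z
    hasF        : Contains lF Z
    isPrimitive : Primitive Z
open StarShaped

node-shaped : ∀ {n A a B} → Perfect n A → Perfect n B → Separated A B
  → Contains lT (node A a B) → Contains lF (node A a B) → StarShaped (node A a B)
node-shaped {n} {a = a} pA pB sep cT cF = record
  { height = suc n ; perfect = nodeᵖ pA pB ; hasT = cT ; hasF = cF ; isPrimitive = primitive-node {a = a} sep }

tterm-separated : ∀ {P} → TTerm P → Separated (fe P) (rep1 (fe P) lT (leaf lF))
tterm-separated {P} p = separated-by-leaf (tterm-contains p) (rep1-removes (fe P) (λ ()))

tterm-negated-F : ∀ {P} → TTerm P → Contains lF (rep1 (fe P) lT (leaf lF))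
tterm-negated-F {P} p = contains-subst (fe P) (tterm-contains p) here

lterm-shaped : ∀ {Q} → LTerm Q → StarShaped (fe Q)
lterm-shaped (lPos a p) with tterm-perfect p
... | _ , q = node-shaped q (rep1-perfect q) (tterm-separated p)
                (left (tterm-contains p)) (right (tterm-negated-F p))
lterm-shaped (lNeg a p) with tterm-perfect p
... | _ , q = node-shaped (rep1-perfect q) q (separated-sym (tterm-separated p))
                (right (tterm-contains p)) (left (tterm-negated-F p))

rep2-shaped : ∀ {X A B m} → StarShaped X → In𝒯 X → Perfect m A → Perfect m B → In𝒯 A → In𝒯 B
  → Separated A B → Contains lT A → Contains lF A ⊎ Contains lF B → StarShaped (rep2 X lT A lF B)
rep2-shaped {X} {A} {B} {m} sX nX pA pB nA nB sep tA fAB = record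
  { height      = height sX + m
  ; perfect     = perfect-subst (perfect sX) perfect-image
  ; hasT        = contains-subst X (hasT sX) tA
  ; hasF        = hasF-result fAB
  ; isPrimitive = primitive-subst X (perfect sX) (isPrimitive sX) (hasT sX) (hasF sX)
                    (leaf-injective refl nA nB (separated-distinct sep)) sep
  }
  where
  perfect-image : ∀ {l} → Contains l X → Perfect m (rep2 (leaf l) lT A lF B)
  perfect-image {lT} _ = pA
  perfect-image {lF} _ = pB
  perfect-image {□}  c = ⊥-elim (nX c)

  hasF-result : Contains lF A ⊎ Contains lF B → Contains lF (rep2 X lT A lF B)
  hasF-result (inj₁ fA) = contains-subst X (hasT sX) fA
  hasF-result (inj₂ fB) = contains-subst X (hasF sX) fB

star-shaped : ∀ {Q} → StarTerm Q → StarShaped (fe Q)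
conj-shaped : ∀ {Q} → CTerm Q → StarShaped (fe Q)
disj-shaped : ∀ {Q} → DTerm Q → StarShaped (fe Q)

star-shaped (sC c) = conj-shaped c
star-shaped (sD d) = disj-shaped d

conj-shaped (cL l) = lterm-shaped l
conj-shaped {Q₁ ∧• Q₂} (cAnd s d) =
  rep2-shaped (star-shaped s) (fe-In𝒯 Q₁) (perfect s₂) (rep1-perfect (perfect s₂))
    (fe-In𝒯 Q₂) (rep1-In𝒯 (fe Q₂) (fe-In𝒯 Q₂) (λ ()))
    (separated-by-leaf (hasT s₂) (rep1-removes (fe Q₂) (λ ()))) (hasT s₂) (inj₁ (hasF s₂))
  where
  s₂ : StarShaped (fe Q₂)
  s₂ = disj-shaped d

disj-shaped (dL l) = lterm-shaped l
disj-shaped {Q₁ ∨• Q₂} (dOr s c) =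
  rep2-shaped (star-shaped s) (fe-In𝒯 Q₁) (rep1-perfect (perfect s₂)) (perfect s₂)
    (rep1-In𝒯 (fe Q₂) (fe-In𝒯 Q₂) (λ ())) (fe-In𝒯 Q₂)
    (separated-sym (separated-by-leaf (hasF s₂) (rep1-removes (fe Q₂) (λ ()))))
    (contains-subst (fe Q₂) (hasF s₂) here) (inj₂ (hasF s₂))
  where
  s₂ : StarShaped (fe Q₂)
  s₂ = conj-shaped c

-- Decompositions by templates.

Template : Tree → Set
Template U = ¬ Contains lT U × ¬ Contains lF U

only□-template : ∀ {U} → OnlyLeaf □ U → Template U
only□-template {U} only = noT , noF
  where
  noT : ¬ Contains lT U
  noT c with only c
  ... | ()
  noF : ¬ Contains lF U
  noF c with only c
  ... | ()

cut : ℕ → Tree → Tree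
cut zero    X            = leaf □
cut (suc k) (leaf l)     = leaf l
cut (suc k) (node X a Y) = node (cut k X) a (cut k Y)

cut-copies : ∀ k {V X} → Copies k V X → X ≡ rep1 (cut k X) □ V
cut-copies zero    t = t
cut-copies (suc k) {X = node X a Y} (t₁ , t₂) = cong₂ (λ L R → node L a R) (cut-copies k t₁) (cut-copies k t₂)

cut-only : ∀ k {V X} → Copies k V X → OnlyLeaf □ (cut k X)
cut-only zero    _ here = refl
cut-only (suc k) {X = node X a Y} (t₁ , _) (left c)  = cut-only k t₁ c
cut-only (suc k) {X = node X a Y} (_ , t₂) (right c) = cut-only k t₂ c

cut-contains-□ : ∀ k {V X} → Copies k V X → Contains □ (cut k X)
cut-contains-□ zero    _ = here
cut-contains-□ (suc k) {X = node X a Y} (t₁ , _) = left (cut-contains-□ k t₁)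

cut-proper : ∀ j {V X} → Copies (suc j) V X → cut (suc j) X ≢ leaf □
cut-proper j {X = leaf _}     ()
cut-proper j {X = node X a Y} _ ()

-- Z = U[□ ↦ V] for a template U ≠ □: the negated maximality condition of IsTSD
Reducible : Tree → Set
Reducible Z = Σ Tree λ U → Σ Tree λ V →
  In𝒯 V × Z ≡ rep1 U □ V × Contains □ U × U ≢ leaf □ × ¬ Contains lT U × ¬ Contains lF U

copies-reducible : ∀ j {V Z} → In𝒯 V → Copies (suc j) V Z → Reducible Z
copies-reducible j {V} {Z} nV t =
  cut (suc j) Z , V , nV , cut-copies (suc j) t , cut-contains-□ (suc j) t , cut-proper j t ,
  proj₁ template , proj₂ template
  where
  template : Template (cut (suc j) Z)
  template = only□-template (cut-only (suc j) t)

template-decomposition : ∀ U {V n} → Template U → Perfect n (rep1 U □ V)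
  → Σ ℕ λ k → Σ ℕ λ m → Perfect m V × k + m ≡ n × Copies k V (rep1 U □ V) × cut k (rep1 U □ V) ≡ U
template-decomposition (leaf lT) (noT , _) _ = ⊥-elim (noT here)
template-decomposition (leaf lF) (_ , noF) _ = ⊥-elim (noF here)
template-decomposition (leaf □) {n = n} _ p = 0 , n , p , refl , refl , refl
template-decomposition (node U₁ a U₂) (noT , noF) (nodeᵖ p₁ p₂)
  with template-decomposition U₁ ((λ c → noT (left c)) , (λ c → noF (left c))) p₁
     | template-decomposition U₂ ((λ c → noT (right c)) , (λ c → noF (right c))) p₂
... | k₁ , m , q₁ , e₁ , t₁ , c₁ | k₂ , _ , q₂ , e₂ , t₂ , c₂ with perfect-unique q₁ q₂
... | refl with +-cancelʳ-≡ m k₁ k₂ (trans e₁ (sym e₂))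
... | refl = suc k₁ , m , q₁ , cong suc e₁ , (t₁ , t₂) , cong₂ (λ L R → node L a R) c₁ c₂

tsd-copies : ∀ {n X Y Z} → Perfect n X → X ≡ rep1 Y □ Z → Template Y → Σ ℕ λ k → Copies k Z X × cut k X ≡ Y
tsd-copies {Y = Y} p refl tY with template-decomposition Y tY p
... | k , _ , _ , _ , t , c = k , t , c

primitive-irreducible : ∀ {n Z} → Perfect n Z → Primitive Z → ¬ Reducible Z
primitive-irreducible p prim (U , V , _ , eq , _ , proper , noT , noF) with tsd-copies p eq (noT , noF)
... | zero  , _ , cutU = proper (sym cutU)
... | suc j , t , _    = prim j V t

tiles-nested : ∀ {k k' X Z Z'} → Copies k Z X → Copies k' Z' X → k ≤ k' → ¬ Reducible Z → In𝒯 Z'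
  → k ≡ k' × Z' ≡ Z
tiles-nested {k} tZ tZ' k≤k' irr nZ' with m≤n⇒∃[o]m+o≡n k≤k'
... | zero  , refl = sym (+-identityʳ k) , sym (copies-split k tZ tZ')
... | suc d , refl = ⊥-elim (irr (copies-reducible d nZ' (copies-split k tZ tZ')))

tsd-unique : ∀ {n X Y Z Y' Z'} → Perfect n X → IsTSD X Y Z → IsTSD X Y' Z' → Y' ≡ Y × Z' ≡ Z
tsd-unique p (nZ , eq , noT , noF , irr) (nZ' , eq' , noT' , noF' , irr')
  with tsd-copies p eq (noT , noF) | tsd-copies p eq' (noT' , noF')
... | k , tZ , cutY | k' , tZ' , cutY' with ≤-total k k'
... | inj₁ k≤k' with tiles-nested tZ tZ' k≤k' irr nZ'
...   | refl , refl = trans (sym cutY') cutY , refl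
tsd-unique p (nZ , eq , noT , noF , irr) (nZ' , eq' , noT' , noF' , irr')
    | k , tZ , cutY | k' , tZ' , cutY' | inj₂ k'≤k with tiles-nested tZ' tZ k'≤k irr' nZ
...   | refl , refl = trans (sym cutY') cutY , refl

-- fe (P ∧• Q) = fe P[T ↦ □][□ ↦ fe Q], as fe P has only T-leaves
conj-split : ∀ {P} Q → TTerm P → fe (P ∧• Q) ≡ rep1 (rep1 (fe P) lT (leaf □)) □ (fe Q)
conj-split {P} Q tP = trans (subst-only (fe P) (tterm-only tP) refl) (sym (subst-subst (fe P)))

conj-perfect : ∀ {P Q} → TTerm P → StarShaped (fe Q) → Σ ℕ λ n → Perfect n (fe (P ∧• Q))
conj-perfect tP sQ with tterm-perfect tP
... | n , pP = n + height sQ , perfect-subst-only pP (tterm-only tP) (perfect sQ)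

mainTheorem10 : ∀ {P Q} → TTerm P → StarTerm Q →
    IsUniqueTSD (fe (P ∧• Q)) (rep1 (fe P) lT (leaf □)) (fe Q)
mainTheorem10 {P} {Q} tP sQ =
  decomposition , λ Y' Z' → tsd-unique (proj₂ (conj-perfect {Q = Q} tP shapeQ)) decomposition
  where
  shapeQ : StarShaped (fe Q)
  shapeQ = star-shaped sQ

  templateY : Template (rep1 (fe P) lT (leaf □))
  templateY = only□-template (rep1-only (fe P) (tterm-only tP) (λ { here → refl }))

  decomposition : IsTSD (fe (P ∧• Q)) (rep1 (fe P) lT (leaf □)) (fe Q)
  decomposition = fe-In𝒯 Q , conj-split Q tP , proj₁ templateY , proj₂ templateY ,
                  primitive-irreducible (perfect shapeQ) (isPrimitive shapeQ)
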